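{- Let $l \leq k$ be non-negative integers. Then the total number, summed over all Dyck paths of semilength $k$, of intervals of length $k$ containing exactly $l$ falls equals $\binom{k}{l}^2$.
   Context: A Dyck path of semilength $k$ is a lattice path in $\mathbb{Z}^2$ from $(0,0)$ to $(2k,0)$ that never goes below the $x$-axis and each of whose steps is either $(1,1)$ (a rise) or $(1,-1)$ (a fall). An interval of length $m$ in such a path is a sequence of $m$ consecutive steps of the path; intervals in a given path are counted by their starting position. -}

module Defs where

open import Data.Bool using (Bool; true; false; if_then_else_)
open import Data.Nat using (ℕ; zero; suc; _+_; _*_; _∸_; _≡ᵇ_)
open import Data.Nat.ListAction using (sum)
open import Data.List using (List; []; _∷_; map; concatMap; length; filter; take; drop; upTo; replicate)
open import Data.List.Relation.Unary.All using (All)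
open import Relation.Binary.PropositionalEquality using (_≡_)
open import Relation.Nullary using (Dec; yes; no)

-- A lattice path is a list of steps: true = rise (1,1), false = fall (1,-1).
Step : Set
Step = Bool

staysAndReturns : ℕ → List Step → Bool
staysAndReturns zero    []           = true
staysAndReturns (suc h) []           = false
staysAndReturns h       (true  ∷ p)  = staysAndReturns (suc h) p
staysAndReturns zero    (false ∷ p)  = false
staysAndReturns (suc h) (false ∷ p)  = staysAndReturns h p

allPaths : ℕ → List (List Step)
allPaths zero    = [] ∷ []
allPaths (suc n) = concatMap (λ p → (true ∷ p) ∷ (false ∷ p) ∷ []) (allPaths n)

dyckPaths : ℕ → List (List Step)
dyckPaths k = filter (λ p → Data.Bool._≟_ (staysAndReturns 0 p) true) (allPaths (2 * k))
  where import Data.Bool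

falls : List Step → ℕ
falls []           = 0
falls (true  ∷ p)  = falls p
falls (false ∷ p)  = suc (falls p)

-- The interval of length m starting at position i (0-based).
interval : ℕ → ℕ → List Step → List Step
interval i m p = take m (drop i p)

countIntervals : ℕ → ℕ → List Step → ℕ
countIntervals m l p =
  length (filter (λ i → falls (interval i m p) Data.Nat.≟ l)
                 (upTo (suc (length p ∸ m))))
  where import Data.Nat

totalIntervals : ℕ → ℕ → ℕ
totalIntervals k l = sum (map (countIntervals k l) (dyckPaths k))

{-# OPTIONS --safe #-}
module Submission where

-- Cut a Dyck path of semilength k around its interval of length k at position i into
-- A M R, of lengths i, k and k − i.  If A ends at height h and M has l falls, then M ends
-- at height h + k − 2l.  By the reflection principle there are C(k,l) − C(k, l−h−1) such
-- middles M that stay above the axis.  Summed over i, the pairs (A, R) are counted by a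
-- last-visit decomposition: they correspond to nonnegative paths of length k + 1 from 0 to
-- 2h + k − 2l + 1, whose number for h = l − j is the ballot number C(k+1, j) − C(k+1, j−1).
-- Summed over 0 ≤ j ≤ min(l, k − l), the products telescope (Pascal's rule) to C(k,l)².

open import Defs
open import Data.Bool using (Bool; true; false)
import Data.Bool as Bool
open import Data.Integer using (ℤ)
import Data.Integer as ℤ
import Data.Integer.Properties as ℤ
import Data.Integer.Tactic.RingSolver as ℤ-Ring
open import Data.List using (List; []; _∷_; _++_; map; concatMap; length; filter; take; upTo; applyUpTo)
open import Data.List.Properties using (map-cong; map-++; map-upTo)
open import Data.Nat using (ℕ; zero; suc; pred; _+_; _*_; _∸_; _≤_; _<_; _≡ᵇ_; _≟_; _⊓_; z≤n; s≤s; z<s; s<s)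
open import Data.Nat.Properties
open import Data.Nat.Combinatorics using (_C_; nCk+nC[k+1]≡[n+1]C[k+1]; nCk≡nC[n∸k])
open import Data.Nat.ListAction using (sum)
open import Data.Nat.ListAction.Properties using (sum-++)
open import Data.Nat.Tactic.RingSolver using (solve-∀)
open import Data.Sum using (_⊎_; inj₁; inj₂)
open import Function using (_∘_; const)
open import Relation.Binary.PropositionalEquality
open import Relation.Nullary using (Dec; does; yes; no)
open import Relation.Nullary.Decidable using (dec-true; dec-false)

𝟙 : Bool → ℕ
𝟙 true  = 1
𝟙 false = 0

δ : ℕ → ℕ → ℕ
δ m n = 𝟙 (m ≡ᵇ n)

δ-≡ : ∀ {m n} → m ≡ n → δ m n ≡ 1
δ-≡ {m} {n} m≡n = cong 𝟙 (dec-true (m ≟ n) m≡n)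

δ-≢ : ∀ {m n} → m ≢ n → δ m n ≡ 0
δ-≢ {m} {n} m≢n = cong 𝟙 (dec-false (m ≟ n) m≢n)

δ-subst : ∀ m n (φ : ℕ → ℕ) → δ m n * φ m ≡ δ m n * φ n
δ-subst m n φ with m ≟ n
... | yes refl = refl
... | no  m≢n  rewrite δ-≢ m≢n = refl

δ-+-2* : ∀ x y x′ y′ → x + 2 * y ≡ x′ + 2 * y′ → δ x x′ ≡ δ y y′
δ-+-2* x y x′ y′ eq with y ≟ y′
... | yes refl = trans (δ-≡ (+-cancelʳ-≡ (2 * y) x x′ eq)) (sym (δ-≡ {y} refl))
... | no  y≢y′ = trans (δ-≢ x≢x′) (sym (δ-≢ y≢y′))
  where
  x≢x′ : x ≢ x′
  x≢x′ refl = y≢y′ (*-cancelˡ-≡ y y′ 2 (+-cancelˡ-≡ x _ _ eq))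

sum-map-+ : ∀ {A : Set} (f g : A → ℕ) xs →
            sum (map (λ x → f x + g x) xs) ≡ sum (map f xs) + sum (map g xs)
sum-map-+ f g []       = refl
sum-map-+ f g (x ∷ xs) = begin
  f x + g x + sum (map (λ x → f x + g x) xs)    ≡⟨ cong ((f x + g x) +_) (sum-map-+ f g xs) ⟩
  f x + g x + (sum (map f xs) + sum (map g xs)) ≡⟨ +-+-comm (f x) (g x) _ _ ⟩
  f x + sum (map f xs) + (g x + sum (map g xs)) ∎
  where
  open ≡-Reasoning
  +-+-comm : ∀ a b c d → a + b + (c + d) ≡ a + c + (b + d)
  +-+-comm = solve-∀

sum-map-*ˡ : ∀ {A : Set} c (f : A → ℕ) xs → sum (map (λ x → c * f x) xs) ≡ c * sum (map f xs)
sum-map-*ˡ c f []       = sym (*-zeroʳ c)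
sum-map-*ˡ c f (x ∷ xs) = trans (cong (c * f x +_) (sum-map-*ˡ c f xs)) (sym (*-distribˡ-+ c (f x) _))

sum-map-zero : ∀ {A : Set} (xs : List A) → sum (map (const 0) xs) ≡ 0
sum-map-zero []       = refl
sum-map-zero (x ∷ xs) = sum-map-zero xs

sum-map-concatMap : ∀ {A B : Set} (f : B → ℕ) (g : A → List B) xs →
                    sum (map f (concatMap g xs)) ≡ sum (map (λ x → sum (map f (g x))) xs)
sum-map-concatMap f g []       = refl
sum-map-concatMap f g (x ∷ xs) = begin
  sum (map f (g x ++ concatMap g xs))              ≡⟨ cong sum (map-++ f (g x) _) ⟩
  sum (map f (g x) ++ map f (concatMap g xs))      ≡⟨ sum-++ (map f (g x)) _ ⟩
  sum (map f (g x)) + sum (map f (concatMap g xs)) ≡⟨ cong (sum (map f (g x)) +_) (sum-map-concatMap f g xs) ⟩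
  sum (map f (g x)) + sum (map (λ x → sum (map f (g x))) xs) ∎
  where open ≡-Reasoning

sum-map-filter : ∀ {A : Set} {P : A → Set} (P? : ∀ x → Dec (P x)) (f : A → ℕ) xs →
                 sum (map f (filter P? xs)) ≡ sum (map (λ x → 𝟙 (does (P? x)) * f x) xs)
sum-map-filter P? f []       = refl
sum-map-filter P? f (x ∷ xs) with does (P? x)
... | true  = cong₂ _+_ (sym (+-identityʳ (f x))) (sum-map-filter P? f xs)
... | false = sum-map-filter P? f xs

length-filter : ∀ {A : Set} {P : A → Set} (P? : ∀ x → Dec (P x)) xs →
                length (filter P? xs) ≡ sum (map (𝟙 ∘ does ∘ P?) xs)
length-filter P? []       = refl
length-filter P? (x ∷ xs) with does (P? x)
... | true  = cong suc (length-filter P? xs)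
... | false = length-filter P? xs

Σ< : ℕ → (ℕ → ℕ) → ℕ
Σ< n f = sum (applyUpTo f n)

Σ<-upTo : ∀ n (f : ℕ → ℕ) → Σ< n f ≡ sum (map f (upTo n))
Σ<-upTo n f = cong sum (sym (map-upTo f n))

Σ<-cong : ∀ n {f g : ℕ → ℕ} → (∀ i → i < n → f i ≡ g i) → Σ< n f ≡ Σ< n g
Σ<-cong zero    f≡g = refl
Σ<-cong (suc n) f≡g = cong₂ _+_ (f≡g 0 z<s) (Σ<-cong n (λ i i<n → f≡g (suc i) (s<s i<n)))

Σ<-ext : ∀ n {f g : ℕ → ℕ} → (∀ i → f i ≡ g i) → Σ< n f ≡ Σ< n g
Σ<-ext n f≡g = Σ<-cong n (λ i _ → f≡g i)

Σ<-+ : ∀ n (f g : ℕ → ℕ) → Σ< n (λ i → f i + g i) ≡ Σ< n f + Σ< n g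
Σ<-+ n f g = trans (Σ<-upTo n _) (trans (sum-map-+ f g (upTo n)) (sym (cong₂ _+_ (Σ<-upTo n f) (Σ<-upTo n g))))

Σ<-*ˡ : ∀ n c (f : ℕ → ℕ) → Σ< n (λ i → c * f i) ≡ c * Σ< n f
Σ<-*ˡ n c f = trans (Σ<-upTo n _) (trans (sum-map-*ˡ c f (upTo n)) (cong (c *_) (sym (Σ<-upTo n f))))

Σ<-vanish : ∀ n {f : ℕ → ℕ} → (∀ i → i < n → f i ≡ 0) → Σ< n f ≡ 0
Σ<-vanish zero    f≡0 = refl
Σ<-vanish (suc n) f≡0 = cong₂ _+_ (f≡0 0 z<s) (Σ<-vanish n (λ i i<n → f≡0 (suc i) (s<s i<n)))

Σ<-truncate : ∀ {m n} (f : ℕ → ℕ) → m ≤ n → (∀ i → m ≤ i → i < n → f i ≡ 0) → Σ< n f ≡ Σ< m f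
Σ<-truncate {zero}  {n}     f m≤n       f≡0 = Σ<-vanish n (λ i → f≡0 i z≤n)
Σ<-truncate {suc m} {suc n} f (s≤s m≤n) f≡0 =
  cong (f 0 +_) (Σ<-truncate (f ∘ suc) m≤n (λ i m≤i i<n → f≡0 (suc i) (s≤s m≤i) (s<s i<n)))

Σ<-snoc : ∀ n (f : ℕ → ℕ) → Σ< (suc n) f ≡ Σ< n f + f n
Σ<-snoc zero    f = +-comm (f 0) 0
Σ<-snoc (suc n) f = trans (cong (f 0 +_) (Σ<-snoc n (f ∘ suc))) (sym (+-assoc (f 0) _ _))

Σ<-reverse : ∀ n (f : ℕ → ℕ) → Σ< (suc n) f ≡ Σ< (suc n) (λ i → f (n ∸ i))
Σ<-reverse zero    f = refl
Σ<-reverse (suc n) f = begin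
  Σ< (suc (suc n)) f                        ≡⟨ Σ<-snoc (suc n) f ⟩
  Σ< (suc n) f + f (suc n)                  ≡⟨ cong (_+ f (suc n)) (Σ<-reverse n f) ⟩
  Σ< (suc n) (λ i → f (n ∸ i)) + f (suc n)  ≡⟨ +-comm _ (f (suc n)) ⟩
  f (suc n) + Σ< (suc n) (λ i → f (n ∸ i))  ∎
  where open ≡-Reasoning

Σ<-swap : ∀ m n (f : ℕ → ℕ → ℕ) → Σ< m (λ i → Σ< n (f i)) ≡ Σ< n (λ j → Σ< m (λ i → f i j))
Σ<-swap zero    n f = sym (Σ<-vanish n (λ _ _ → refl))
Σ<-swap (suc m) n f = trans (cong (Σ< n (f 0) +_) (Σ<-swap m n (f ∘ suc))) (sym (Σ<-+ n (f 0) _))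

Σ<-δ : ∀ n {x} (f : ℕ → ℕ) → x < n → Σ< n (λ i → δ x i * f i) ≡ f x
Σ<-δ (suc n) {zero}  f _ =
  trans (cong (f 0 + 0 +_) (Σ<-vanish n (λ _ _ → refl))) (trans (+-identityʳ _) (+-identityʳ _))
Σ<-δ (suc n) {suc x} f (s<s x<n) = Σ<-δ n (f ∘ suc) x<n

Σ<-convolution-snoc : ∀ n (a b : ℕ → ℕ) →
  Σ< (suc (suc n)) (λ i → a i * b (suc n ∸ i)) ≡ Σ< (suc n) (λ i → a i * b (suc (n ∸ i))) + a (suc n) * b 0
Σ<-convolution-snoc n a b = trans (Σ<-snoc (suc n) (λ i → a i * b (suc n ∸ i)))
  (cong₂ _+_ (Σ<-cong (suc n) (λ i i<1+n → cong (λ j → a i * b j) (+-∸-assoc 1 (≤-pred i<1+n))))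
             (cong (λ j → a (suc n) * b j) (n∸n≡0 n)))

Σpath : ℕ → (List Step → ℕ) → ℕ
Σpath n f = sum (map f (allPaths n))

Σpath-ext : ∀ n {f g : List Step → ℕ} → (∀ p → f p ≡ g p) → Σpath n f ≡ Σpath n g
Σpath-ext n f≡g = cong sum (map-cong f≡g (allPaths n))

Σpath-+ : ∀ n (f g : List Step → ℕ) → Σpath n (λ p → f p + g p) ≡ Σpath n f + Σpath n g
Σpath-+ n f g = sum-map-+ f g (allPaths n)

Σpath-*ʳ : ∀ n (f : List Step → ℕ) c → Σpath n (λ p → f p * c) ≡ Σpath n f * c
Σpath-*ʳ n f c = begin
  Σpath n (λ p → f p * c)   ≡⟨ Σpath-ext n (λ p → *-comm (f p) c) ⟩
  Σpath n (λ p → c * f p)   ≡⟨ sum-map-*ˡ c f (allPaths n) ⟩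
  c * Σpath n f             ≡⟨ *-comm c _ ⟩
  Σpath n f * c             ∎
  where open ≡-Reasoning

Σpath-zero : ∀ n → Σpath n (const 0) ≡ 0
Σpath-zero n = sum-map-zero (allPaths n)

Σpath-suc : ∀ n (f : List Step → ℕ) → Σpath (suc n) f ≡ Σpath n (λ q → f (true ∷ q) + f (false ∷ q))
Σpath-suc n f = trans (sum-map-concatMap f _ (allPaths n))
                      (Σpath-ext n (λ q → cong (f (true ∷ q) +_) (+-identityʳ _)))

Σpath-cong : ∀ n {f g : List Step → ℕ} → (∀ p → length p ≡ n → f p ≡ g p) → Σpath n f ≡ Σpath n g
Σpath-cong zero    f≡g = cong (_+ 0) (f≡g [] refl)
Σpath-cong (suc n) {f} {g} f≡g = begin
  Σpath (suc n) f                               ≡⟨ Σpath-suc n f ⟩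
  Σpath n (λ q → f (true ∷ q) + f (false ∷ q))  ≡⟨ Σpath-cong n (λ q ∣q∣≡n → cong₂ _+_ (f≡g′ true q ∣q∣≡n)
                                                                                      (f≡g′ false q ∣q∣≡n)) ⟩
  Σpath n (λ q → g (true ∷ q) + g (false ∷ q))  ≡⟨ Σpath-suc n g ⟨
  Σpath (suc n) g                               ∎
  where
  open ≡-Reasoning
  f≡g′ : ∀ s q → length q ≡ n → f (s ∷ q) ≡ g (s ∷ q)
  f≡g′ s q ∣q∣≡n = f≡g (s ∷ q) (cong suc ∣q∣≡n)

Σpath-Σ< : ∀ n m (f : List Step → ℕ → ℕ) →
           Σpath n (λ p → Σ< m (f p)) ≡ Σ< m (λ i → Σpath n (λ p → f p i))
Σpath-Σ< n zero    f = Σpath-zero n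
Σpath-Σ< n (suc m) f =
  trans (Σpath-+ n (λ p → f p 0) _) (cong (Σpath n (λ p → f p 0) +_) (Σpath-Σ< n m (λ p → f p ∘ suc)))

Σpath-++ : ∀ a b (f : List Step → ℕ) → Σpath (a + b) f ≡ Σpath a (λ q → Σpath b (λ r → f (q ++ r)))
Σpath-++ zero    b f = sym (+-identityʳ _)
Σpath-++ (suc a) b f = begin
  Σpath (suc (a + b)) f                                                   ≡⟨ Σpath-suc (a + b) f ⟩
  Σpath (a + b) (λ q → f (true ∷ q) + f (false ∷ q))                      ≡⟨ Σpath-++ a b _ ⟩
  Σpath a (λ q → Σpath b (λ r → f (true ∷ q ++ r) + f (false ∷ q ++ r)))
                                                                          ≡⟨ Σpath-ext a (λ q → Σpath-+ b _ _) ⟩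
  Σpath a (λ q → Σpath b (λ r → f (true ∷ q ++ r)) + Σpath b (λ r → f (false ∷ q ++ r)))
                                                                          ≡⟨ Σpath-suc a _ ⟨
  Σpath (suc a) (λ q → Σpath b (λ r → f (q ++ r)))                        ∎
  where open ≡-Reasoning

Σpath-snoc : ∀ n (f : List Step → ℕ) →
             Σpath (suc n) f ≡ Σpath n (λ q → f (q ++ true ∷ []) + f (q ++ false ∷ []))
Σpath-snoc n f = begin
  Σpath (suc n) f                                                 ≡⟨ cong (λ m → Σpath m f) (+-comm 1 n) ⟩
  Σpath (n + 1) f                                                 ≡⟨ Σpath-++ n 1 f ⟩
  Σpath n (λ q → f (q ++ true ∷ []) + (f (q ++ false ∷ []) + 0))
    ≡⟨ Σpath-ext n (λ q → cong (f _ +_) (+-identityʳ _)) ⟩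
  Σpath n (λ q → f (q ++ true ∷ []) + f (q ++ false ∷ []))        ∎
  where open ≡-Reasoning

rises : List Step → ℕ
rises []          = 0
rises (true  ∷ p) = suc (rises p)
rises (false ∷ p) = rises p

rises+falls : ∀ p → rises p + falls p ≡ length p
rises+falls []          = refl
rises+falls (true  ∷ p) = cong suc (rises+falls p)
rises+falls (false ∷ p) = trans (+-suc (rises p) (falls p)) (cong suc (rises+falls p))

walk : ℕ → List Step → (ℕ → ℕ) → ℕ
walk a       []          g = g a
walk a       (true  ∷ p) g = walk (suc a) p g
walk zero    (false ∷ p) g = 0
walk (suc a) (false ∷ p) g = walk a p g

stays : ℕ → List Step → ℕ
stays a p = walk a p (const 1)

height : ℕ → List Step → ℕ
height a p = a + rises p ∸ falls p

height-≤ : ∀ a p → height a p ≤ a + length p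
height-≤ a p = ≤-trans (m∸n≤m (a + rises p) (falls p))
                       (+-monoʳ-≤ a (subst (rises p ≤_) (rises+falls p) (m≤m+n (rises p) (falls p))))

height-by-falls : ∀ a p → height a p ≡ a + (length p ∸ falls p) ∸ falls p
height-by-falls a p = cong (λ r → a + r ∸ falls p) (sym rises≡∣p∣∸falls)
  where
  rises≡∣p∣∸falls : length p ∸ falls p ≡ rises p
  rises≡∣p∣∸falls = trans (cong (_∸ falls p) (sym (rises+falls p))) (m+n∸n≡m (rises p) (falls p))

walk-ext : ∀ a p {g g′ : ℕ → ℕ} → (∀ e → g e ≡ g′ e) → walk a p g ≡ walk a p g′
walk-ext a       []          g≡g′ = g≡g′ a
walk-ext a       (true  ∷ p) g≡g′ = walk-ext (suc a) p g≡g′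
walk-ext zero    (false ∷ p) g≡g′ = refl
walk-ext (suc a) (false ∷ p) g≡g′ = walk-ext a p g≡g′

walk-++ : ∀ a p q (g : ℕ → ℕ) → walk a (p ++ q) g ≡ walk a p (λ b → walk b q g)
walk-++ a       []          q g = refl
walk-++ a       (true  ∷ p) q g = walk-++ (suc a) p q g
walk-++ zero    (false ∷ p) q g = refl
walk-++ (suc a) (false ∷ p) q g = walk-++ a p q g

walk-*ʳ : ∀ a p (g : ℕ → ℕ) c → walk a p g * c ≡ walk a p (λ e → g e * c)
walk-*ʳ a       []          g c = refl
walk-*ʳ a       (true  ∷ p) g c = walk-*ʳ (suc a) p g c
walk-*ʳ zero    (false ∷ p) g c = refl
walk-*ʳ (suc a) (false ∷ p) g c = walk-*ʳ a p g c

Σpath-walk : ∀ n a p (F : ℕ → List Step → ℕ) →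
             Σpath n (λ q → walk a p (λ e → F e q)) ≡ walk a p (λ e → Σpath n (F e))
Σpath-walk n a       []          F = refl
Σpath-walk n a       (true  ∷ p) F = Σpath-walk n (suc a) p F
Σpath-walk n zero    (false ∷ p) F = Σpath-zero n
Σpath-walk n (suc a) (false ∷ p) F = Σpath-walk n a p F

walk-height : ∀ a p (g : ℕ → ℕ) → walk a p g ≡ stays a p * g (height a p)
walk-height a       []          g = sym (trans (+-identityʳ _) (cong g (+-identityʳ a)))
walk-height a       (true  ∷ p) g rewrite +-suc a (rises p) = walk-height (suc a) p g
walk-height zero    (false ∷ p) g = refl
walk-height (suc a) (false ∷ p) g = walk-height a p g

stays-bound : ∀ a p → stays a p ≡ 0 ⊎ falls p ≤ a + rises p
stays-bound a       []          = inj₂ z≤n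
stays-bound a       (true  ∷ p) rewrite +-suc a (rises p) = stays-bound (suc a) p
stays-bound zero    (false ∷ p) = inj₁ refl
stays-bound (suc a) (false ∷ p) with stays-bound a p
... | inj₁ stays≡0 = inj₁ stays≡0
... | inj₂ falls≤  = inj₂ (s≤s falls≤)

walk-byHeight : ∀ n a p (g : ℕ → ℕ) → height a p < n →
                walk a p g ≡ Σ< n (λ h → walk a p (λ e → δ e h) * g h)
walk-byHeight n a p g height<n = begin
  walk a p g                                         ≡⟨ walk-height a p g ⟩
  stays a p * g (height a p)                         ≡⟨ cong (stays a p *_) (Σ<-δ n g height<n) ⟨
  stays a p * Σ< n (λ h → δ (height a p) h * g h)    ≡⟨ Σ<-*ˡ n (stays a p) _ ⟨
  Σ< n (λ h → stays a p * (δ (height a p) h * g h))  ≡⟨ Σ<-ext n (λ h → *-assoc (stays a p) _ (g h)) ⟨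
  Σ< n (λ h → stays a p * δ (height a p) h * g h)    ≡⟨ Σ<-ext n (λ h → cong (_* g h) (walk-height a p _)) ⟨
  Σ< n (λ h → walk a p (λ e → δ e h) * g h)          ∎
  where open ≡-Reasoning

staysAndReturns≡walk : ∀ a p → 𝟙 (staysAndReturns a p) ≡ walk a p (λ e → δ e 0)
staysAndReturns≡walk zero    []          = refl
staysAndReturns≡walk (suc a) []          = refl
staysAndReturns≡walk zero    (true  ∷ p) = staysAndReturns≡walk 1 p
staysAndReturns≡walk (suc a) (true  ∷ p) = staysAndReturns≡walk (suc (suc a)) p
staysAndReturns≡walk zero    (false ∷ p) = refl
staysAndReturns≡walk (suc a) (false ∷ p) = staysAndReturns≡walk a p

walks : ℕ → ℕ → ℕ → ℕ
walks n a b = Σpath n (λ p → walk a p (λ e → δ e b))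

walksFalls : ℕ → ℕ → ℕ → ℕ
walksFalls n a f = Σpath n (λ p → stays a p * δ (falls p) f)

walks-from0 : ∀ n b → walks (suc n) 0 b ≡ walks n 1 b
walks-from0 n b = trans (Σpath-suc n _) (Σpath-ext n (λ q → +-identityʳ _))

walks-suc : ∀ n a b → walks (suc n) (suc a) b ≡ walks n (suc (suc a)) b + walks n a b
walks-suc n a b = trans (Σpath-suc n _) (Σpath-+ n _ _)

walks-to-suc : ∀ n a b → walks (suc n) a (suc b) ≡ walks n a b + walks n a (suc (suc b))
walks-to-suc n a b = begin
  walks (suc n) a (suc b)                                                       ≡⟨ Σpath-snoc n _ ⟩
  Σpath n (λ q → walk a (q ++ true ∷ []) to1+b + walk a (q ++ false ∷ []) to1+b) ≡⟨ Σpath-ext n lastStep ⟩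
  Σpath n (λ q → walk a q (λ e → δ e b) + walk a q (λ e → δ e (suc (suc b))))   ≡⟨ Σpath-+ n _ _ ⟩
  walks n a b + walks n a (suc (suc b))                                         ∎
  where
  open ≡-Reasoning
  to1+b : ℕ → ℕ
  to1+b e = δ e (suc b)
  fall : ∀ e → walk e (false ∷ []) to1+b ≡ δ e (suc (suc b))
  fall zero    = refl
  fall (suc e) = refl
  lastStep : ∀ q → walk a (q ++ true ∷ []) to1+b + walk a (q ++ false ∷ []) to1+b
                 ≡ walk a q (λ e → δ e b) + walk a q (λ e → δ e (suc (suc b)))
  lastStep q = cong₂ _+_ (walk-++ a q _ to1+b) (trans (walk-++ a q _ to1+b) (walk-ext a q fall))

walksFalls-from0 : ∀ n f → walksFalls (suc n) 0 f ≡ walksFalls n 1 f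
walksFalls-from0 n f = trans (Σpath-suc n _) (Σpath-ext n (λ q → +-identityʳ _))

walksFalls-suc-0 : ∀ n a → walksFalls (suc n) (suc a) 0 ≡ walksFalls n (suc (suc a)) 0
walksFalls-suc-0 n a = trans (Σpath-suc n _) (Σpath-ext n noFall)
  where
  noFall : ∀ q → stays (suc (suc a)) q * δ (falls q) 0 + stays a q * 0 ≡ stays (suc (suc a)) q * δ (falls q) 0
  noFall q = trans (cong (stays (suc (suc a)) q * δ (falls q) 0 +_) (*-zeroʳ (stays a q))) (+-identityʳ _)

walksFalls-suc-suc : ∀ n a f →
                     walksFalls (suc n) (suc a) (suc f) ≡ walksFalls n (suc (suc a)) (suc f) + walksFalls n a f
walksFalls-suc-suc n a f = trans (Σpath-suc n _) (Σpath-+ n _ _)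

walks-unreachable : ∀ n a b → a + n < b → walks n a b ≡ 0
walks-unreachable n a b a+n<b = trans (Σpath-cong n unreachable) (Σpath-zero n)
  where
  unreachable : ∀ p → length p ≡ n → walk a p (λ e → δ e b) ≡ 0
  unreachable p refl = begin
    walk a p (λ e → δ e b)        ≡⟨ walk-height a p _ ⟩
    stays a p * δ (height a p) b  ≡⟨ cong (stays a p *_) (δ-≢ (<⇒≢ (≤-<-trans (height-≤ a p) a+n<b))) ⟩
    stays a p * 0                 ≡⟨ *-zeroʳ (stays a p) ⟩
    0                             ∎
    where open ≡-Reasoning

walks≡walksFalls : ∀ n a b f → b + 2 * f ≡ a + n → walks n a b ≡ walksFalls n a f
walks≡walksFalls n a b f b+2f≡a+n =
  Σpath-cong n (λ p ∣p∣≡n → trans (walk-height a p _) (byEnd p ∣p∣≡n (stays-bound a p)))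
  where
  byEnd : ∀ p → length p ≡ n → stays a p ≡ 0 ⊎ falls p ≤ a + rises p →
          stays a p * δ (height a p) b ≡ stays a p * δ (falls p) f
  byEnd p _     (inj₁ stays≡0) rewrite stays≡0 = refl
  byEnd p refl (inj₂ falls≤) = cong (stays a p *_) (δ-+-2* (height a p) (falls p) b f (begin
    height a p + 2 * falls p        ≡⟨ x+2y≡x+y+y (height a p) (falls p) ⟩
    height a p + falls p + falls p  ≡⟨ cong (_+ falls p) (m∸n+n≡m falls≤) ⟩
    a + rises p + falls p           ≡⟨ +-assoc a (rises p) (falls p) ⟩
    a + (rises p + falls p)         ≡⟨ cong (a +_) (rises+falls p) ⟩
    a + length p                    ≡⟨ b+2f≡a+n ⟨
    b + 2 * f                       ∎))
    where
    open ≡-Reasoning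
    x+2y≡x+y+y : ∀ x y → x + 2 * y ≡ x + y + y
    x+2y≡x+y+y = solve-∀

-- n C⁻ k is n C (k − 1), with n C (−1) read as 0.
_C⁻_ : ℕ → ℕ → ℕ
n C⁻ zero  = 0
n C⁻ suc k = n C k

pascal : ∀ n k → suc n C suc k ≡ n C k + n C suc k
pascal n k = sym (nCk+nC[k+1]≡[n+1]C[k+1] n k)

pascal⁻ : ∀ n k → suc n C k ≡ n C⁻ k + n C k
pascal⁻ n zero    = refl
pascal⁻ n (suc k) = pascal n k

C⁻-pascal : ∀ n k → suc n C⁻ k ≡ n C⁻ pred k + n C⁻ k
C⁻-pascal n zero    = refl
C⁻-pascal n (suc k) = pascal⁻ n k

-- Reflection principle: n C⁻ (f ∸ a) counts the paths from height a with f falls that dip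
-- below the axis (when their end height a + n − 2f is nonnegative).
walksFalls-reflection : ∀ n a f → 2 * f ≤ n + a → walksFalls n a f + n C⁻ (f ∸ a) ≡ n C f
walksFalls-reflection zero    a zero    _    rewrite 0∸n≡0 a = refl
walksFalls-reflection zero    a (suc f) 2f≤a rewrite m≤n⇒m∸n≡0 (≤-trans (m≤m+n (suc f) _) 2f≤a) = refl
walksFalls-reflection (suc n) zero    zero    _ =
  trans (cong (_+ 0) (walksFalls-from0 n 0)) (walksFalls-reflection n 1 0 z≤n)
walksFalls-reflection (suc n) zero    (suc f) 2f≤1+n = begin
  walksFalls (suc n) 0 (suc f) + suc n C f   ≡⟨ cong₂ _+_ (walksFalls-from0 n (suc f)) (pascal⁻ n f) ⟩
  walksFalls n 1 (suc f) + (n C⁻ f + n C f)  ≡⟨ +-assoc (walksFalls n 1 (suc f)) _ _ ⟨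
  walksFalls n 1 (suc f) + n C⁻ f + n C f    ≡⟨ cong (_+ n C f) (walksFalls-reflection n 1 (suc f) 2f≤n+1) ⟩
  n C suc f + n C f                          ≡⟨ +-comm (n C suc f) (n C f) ⟩
  n C f + n C suc f                          ≡⟨ pascal n f ⟨
  suc n C suc f                              ∎
  where
  open ≡-Reasoning
  2f≤n+1 : 2 * suc f ≤ n + 1
  2f≤n+1 = subst (2 * suc f ≤_) (trans (+-identityʳ (suc n)) (+-comm 1 n)) 2f≤1+n
walksFalls-reflection (suc n) (suc a) zero    _ =
  trans (cong (_+ 0) (walksFalls-suc-0 n a)) (walksFalls-reflection n (suc (suc a)) 0 z≤n)
walksFalls-reflection (suc n) (suc a) (suc f) 2f≤n+a = begin
  walksFalls (suc n) (suc a) (suc f) + suc n C⁻ (f ∸ a)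
    ≡⟨ cong₂ _+_ (walksFalls-suc-suc n a f) (C⁻-pascal n (f ∸ a)) ⟩
  (rise + fall) + (n C⁻ pred (f ∸ a) + n C⁻ (f ∸ a))
    ≡⟨ cong (λ k → (rise + fall) + (n C⁻ k + n C⁻ (f ∸ a))) (pred[m∸n]≡m∸[1+n] f a) ⟩
  (rise + fall) + (n C⁻ (f ∸ suc a) + n C⁻ (f ∸ a))
    ≡⟨ +-+-comm rise fall _ _ ⟩
  (rise + n C⁻ (f ∸ suc a)) + (fall + n C⁻ (f ∸ a))
    ≡⟨ cong₂ _+_ (walksFalls-reflection n (suc (suc a)) (suc f) 2f≤n+a+2) (walksFalls-reflection n a f 2f≤n+a′) ⟩
  n C suc f + n C f
    ≡⟨ trans (+-comm (n C suc f) (n C f)) (sym (pascal n f)) ⟩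
  suc n C suc f
    ∎
  where
  open ≡-Reasoning
  rise = walksFalls n (suc (suc a)) (suc f)
  fall = walksFalls n a f
  +-+-comm : ∀ a b c d → a + b + (c + d) ≡ a + c + (b + d)
  +-+-comm = solve-∀
  2f≤n+a+2 : 2 * suc f ≤ n + suc (suc a)
  2f≤n+a+2 = subst (2 * suc f ≤_) (sym (+-suc n (suc a))) 2f≤n+a
  2f≤n+a′ : 2 * f ≤ n + a
  2f≤n+a′ = ≤-pred (≤-pred (subst₂ _≤_ (cong suc (+-suc f (f + 0))) (cong suc (+-suc n a)) 2f≤n+a))

walksFalls-vanish : ∀ n a f → n + a < 2 * f → walksFalls n a f ≡ 0
walksFalls-vanish zero    a       (suc f) _      = refl
walksFalls-vanish (suc n) zero    f       n+a<2f = trans (walksFalls-from0 n f) (walksFalls-vanish n 1 f n+1<2f)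
  where
  n+1<2f : n + 1 < 2 * f
  n+1<2f = subst (_< 2 * f) (trans (+-identityʳ (suc n)) (+-comm 1 n)) n+a<2f
walksFalls-vanish (suc n) (suc a) (suc f) n+a<2f = trans (walksFalls-suc-suc n a f)
  (cong₂ _+_ (walksFalls-vanish n (suc (suc a)) (suc f) n+a+2<2f+2) (walksFalls-vanish n a f n+a<2f′))
  where
  n+a+2<2f+2 : n + suc (suc a) < 2 * suc f
  n+a+2<2f+2 = subst (_< 2 * suc f) (sym (+-suc n (suc a))) n+a<2f
  n+a<2f′ : n + a < 2 * f
  n+a<2f′ = ≤-pred (≤-pred (subst₂ _<_ (cong suc (+-suc n a)) (cong suc (+-suc f (f + 0))) n+a<2f))

-- Last-visit decomposition: cut a path from 0 to g + h + 1 at its last visit to height h;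
-- what follows is a rise and then a shifted reversal of a path from g down to 0.
walks-convolution : ∀ n h g → Σ< (suc n) (λ i → walks i 0 h * walks (n ∸ i) g 0) ≡ walks (suc n) 0 (suc (g + h))
walks-convolution zero    zero    zero    = refl
walks-convolution zero    zero    (suc g) = refl
walks-convolution zero    (suc h) zero    = refl
walks-convolution zero    (suc h) (suc g) = refl
walks-convolution (suc n) h zero = begin
  Σ< (suc (suc n)) (λ i → up i * walks (suc n ∸ i) 0 0)
    ≡⟨ Σ<-convolution-snoc n up (λ m → walks m 0 0) ⟩
  Σ< (suc n) (λ i → up i * walks (suc (n ∸ i)) 0 0) + up (suc n) * 1
    ≡⟨ cong₂ _+_ (Σ<-ext (suc n) (λ i → cong (up i *_) (walks-from0 (n ∸ i) 0))) (*-identityʳ _) ⟩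
  Σ< (suc n) (λ i → up i * walks (n ∸ i) 1 0) + up (suc n)
    ≡⟨ cong (_+ up (suc n)) (walks-convolution n h 1) ⟩
  walks (suc n) 0 (suc (suc h)) + walks (suc n) 0 h
    ≡⟨ +-comm _ (walks (suc n) 0 h) ⟩
  walks (suc n) 0 h + walks (suc n) 0 (suc (suc h))
    ≡⟨ walks-to-suc (suc n) 0 h ⟨
  walks (suc (suc n)) 0 (suc h)
    ∎
  where
  open ≡-Reasoning
  up : ℕ → ℕ
  up i = walks i 0 h
walks-convolution (suc n) h (suc g) = begin
  Σ< (suc (suc n)) (λ i → up i * walks (suc n ∸ i) (suc g) 0)
    ≡⟨ Σ<-convolution-snoc n up (λ m → walks m (suc g) 0) ⟩
  Σ< (suc n) (λ i → up i * walks (suc (n ∸ i)) (suc g) 0) + up (suc n) * 0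
    ≡⟨ cong₂ _+_ (Σ<-ext (suc n) firstStep) (*-zeroʳ (up (suc n))) ⟩
  Σ< (suc n) (λ i → up i * down (suc (suc g)) i + up i * down g i) + 0
    ≡⟨ trans (+-identityʳ _) (Σ<-+ (suc n) (λ i → up i * down (suc (suc g)) i) (λ i → up i * down g i)) ⟩
  Σ< (suc n) (λ i → up i * down (suc (suc g)) i) + Σ< (suc n) (λ i → up i * down g i)
    ≡⟨ cong₂ _+_ (walks-convolution n h (suc (suc g))) (walks-convolution n h g) ⟩
  walks (suc n) 0 (suc (suc (suc (g + h)))) + walks (suc n) 0 (suc (g + h))
    ≡⟨ +-comm _ (walks (suc n) 0 (suc (g + h))) ⟩
  walks (suc n) 0 (suc (g + h)) + walks (suc n) 0 (suc (suc (suc (g + h))))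
    ≡⟨ walks-to-suc (suc n) 0 (suc (g + h)) ⟨
  walks (suc (suc n)) 0 (suc (suc (g + h)))
    ∎
  where
  open ≡-Reasoning
  up : ℕ → ℕ
  up i = walks i 0 h
  down : ℕ → ℕ → ℕ
  down g i = walks (n ∸ i) g 0
  firstStep : ∀ i → up i * walks (suc (n ∸ i)) (suc g) 0 ≡ up i * down (suc (suc g)) i + up i * down g i
  firstStep i = trans (cong (up i *_) (walks-suc (n ∸ i) g 0)) (*-distribˡ-+ (up i) _ _)

take-length-++ : ∀ {A : Set} (xs ys : List A) → take (length xs) (xs ++ ys) ≡ xs
take-length-++ []       ys = refl
take-length-++ (x ∷ xs) ys = cong (x ∷_) (take-length-++ xs ys)

interval-++ : ∀ {i k} A M R → length A ≡ i → length M ≡ k → interval i k (A ++ M ++ R) ≡ M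
interval-++ []      M R refl refl = take-length-++ M R
interval-++ (s ∷ A) M R refl refl = interval-++ A M R refl refl

does-≟-true : ∀ b → 𝟙 (does (b Bool.≟ true)) ≡ 𝟙 b
does-≟-true true  = refl
does-≟-true false = refl

countIntervals≡Σ< : ∀ k l p → length p ≡ 2 * k →
                    countIntervals k l p ≡ Σ< (suc k) (λ i → δ (falls (interval i k p)) l)
countIntervals≡Σ< k l p ∣p∣≡2k = begin
  countIntervals k l p                       ≡⟨ length-filter _ (upTo (suc (length p ∸ k))) ⟩
  sum (map hit (upTo (suc (length p ∸ k))))  ≡⟨ Σ<-upTo (suc (length p ∸ k)) hit ⟨
  Σ< (suc (length p ∸ k)) hit                ≡⟨ cong (λ m → Σ< (suc m) hit) ∣p∣∸k≡k ⟩
  Σ< (suc k) hit                             ∎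
  where
  open ≡-Reasoning
  hit : ℕ → ℕ
  hit i = δ (falls (interval i k p)) l
  ∣p∣∸k≡k : length p ∸ k ≡ k
  ∣p∣∸k≡k = trans (cong (_∸ k) ∣p∣≡2k) (trans (m+n∸m≡n k (k + 0)) (+-identityʳ k))

totalIntervals≡Σ<Σpath : ∀ k l → totalIntervals k l
  ≡ Σ< (suc k) (λ i → Σpath (2 * k) (λ p → 𝟙 (staysAndReturns 0 p) * δ (falls (interval i k p)) l))
totalIntervals≡Σ<Σpath k l = begin
  totalIntervals k l
    ≡⟨ sum-map-filter _ (countIntervals k l) (allPaths (2 * k)) ⟩
  Σpath (2 * k) (λ p → 𝟙 (does (staysAndReturns 0 p Bool.≟ true)) * countIntervals k l p)
    ≡⟨ Σpath-cong (2 * k) (λ p ∣p∣≡2k → cong₂ _*_ (does-≟-true (staysAndReturns 0 p))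
                                                  (countIntervals≡Σ< k l p ∣p∣≡2k)) ⟩
  Σpath (2 * k) (λ p → dyck p * Σ< (suc k) (hit p))
    ≡⟨ Σpath-ext (2 * k) (λ p → Σ<-*ˡ (suc k) (dyck p) (hit p)) ⟨
  Σpath (2 * k) (λ p → Σ< (suc k) (λ i → dyck p * hit p i))
    ≡⟨ Σpath-Σ< (2 * k) (suc k) (λ p i → dyck p * hit p i) ⟩
  Σ< (suc k) (λ i → Σpath (2 * k) (λ p → dyck p * hit p i))
    ∎
  where
  open ≡-Reasoning
  dyck : List Step → ℕ
  dyck p = 𝟙 (staysAndReturns 0 p)
  hit : List Step → ℕ → ℕ
  hit p i = δ (falls (interval i k p)) l

endHeight : ℕ → ℕ → ℕ → ℕ
endHeight k l h = h + (k ∸ l) ∸ l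

Σpath-walk-withFalls : ∀ k h l (g : ℕ → ℕ) →
                       Σpath k (λ M → walk h M g * δ (falls M) l) ≡ walksFalls k h l * g (endHeight k l h)
Σpath-walk-withFalls k h l g = trans (Σpath-cong k fixFalls) (Σpath-*ʳ k _ _)
  where
  fixFalls : ∀ M → length M ≡ k → walk h M g * δ (falls M) l ≡ stays h M * δ (falls M) l * g (endHeight k l h)
  fixFalls M refl = begin
    walk h M g * δ (falls M) l                            ≡⟨ cong (_* δ (falls M) l) (walk-height h M g) ⟩
    stays h M * g (height h M) * δ (falls M) l            ≡⟨ cong (λ e → stays h M * g e * δ (falls M) l)
                                                                  (height-by-falls h M) ⟩
    stays h M * g (endAfter (falls M)) * δ (falls M) l    ≡⟨ x*y*z≡x*[z*y] (stays h M) _ _ ⟩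
    stays h M * (δ (falls M) l * g (endAfter (falls M)))  ≡⟨ cong (stays h M *_)
                                                                  (δ-subst (falls M) l (g ∘ endAfter)) ⟩
    stays h M * (δ (falls M) l * g (endAfter l))          ≡⟨ *-assoc (stays h M) _ _ ⟨
    stays h M * δ (falls M) l * g (endAfter l)            ∎
    where
    open ≡-Reasoning
    endAfter : ℕ → ℕ
    endAfter f = h + (length M ∸ f) ∸ f
    x*y*z≡x*[z*y] : ∀ x y z → x * y * z ≡ x * (z * y)
    x*y*z≡x*[z*y] = solve-∀

Σpath-walk-byHeight : ∀ i k (g : ℕ → ℕ) → i ≤ k →
                      Σpath i (λ A → walk 0 A g) ≡ Σ< (suc k) (λ h → walks i 0 h * g h)
Σpath-walk-byHeight i k g i≤k = begin
  Σpath i (λ A → walk 0 A g)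
    ≡⟨ Σpath-cong i (λ A ∣A∣≡i → walk-byHeight (suc k) 0 A g (s≤s (height≤k A ∣A∣≡i))) ⟩
  Σpath i (λ A → Σ< (suc k) (λ h → walk 0 A (λ e → δ e h) * g h))
    ≡⟨ Σpath-Σ< i (suc k) (λ A h → walk 0 A (λ e → δ e h) * g h) ⟩
  Σ< (suc k) (λ h → Σpath i (λ A → walk 0 A (λ e → δ e h) * g h))
    ≡⟨ Σ<-ext (suc k) (λ h → Σpath-*ʳ i (λ A → walk 0 A (λ e → δ e h)) (g h)) ⟩
  Σ< (suc k) (λ h → walks i 0 h * g h)
    ∎
  where
  open ≡-Reasoning
  height≤k : ∀ A → length A ≡ i → height 0 A ≤ k
  height≤k A refl = ≤-trans (height-≤ 0 A) i≤k

dyckIntervalsAt : ∀ k l i → i ≤ k →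
  Σpath (2 * k) (λ p → 𝟙 (staysAndReturns 0 p) * δ (falls (interval i k p)) l)
  ≡ Σ< (suc k) (λ h → walks i 0 h * (walksFalls k h l * walks (k ∸ i) (endHeight k l h) 0))
dyckIntervalsAt k l i i≤k = begin
  Σpath (2 * k) F
    ≡⟨ cong (λ n → Σpath n F) 2k≡i+[k+[k∸i]] ⟩
  Σpath (i + (k + (k ∸ i))) F
    ≡⟨ trans (Σpath-++ i (k + (k ∸ i)) F) (Σpath-ext i (λ A → Σpath-++ k (k ∸ i) (λ q → F (A ++ q)))) ⟩
  Σpath i (λ A → Σpath k (λ M → Σpath (k ∸ i) (λ R → F (A ++ M ++ R))))
    ≡⟨ Σpath-cong i (λ A ∣A∣≡i → Σpath-cong k (λ M ∣M∣≡k →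
         Σpath-ext (k ∸ i) (λ R → split A M R ∣A∣≡i ∣M∣≡k))) ⟩
  Σpath i (λ A → Σpath k (λ M → Σpath (k ∸ i) (λ R → walk 0 A (λ h → Φ h M R))))
    ≡⟨ Σpath-ext i pull ⟩
  Σpath i (λ A → walk 0 A (λ h → Σpath k (λ M → Σpath (k ∸ i) (Φ h M))))
    ≡⟨ Σpath-ext i (λ A → walk-ext 0 A middleAndEnd) ⟩
  Σpath i (λ A → walk 0 A (λ h → walksFalls k h l * walks (k ∸ i) (endHeight k l h) 0))
    ≡⟨ Σpath-walk-byHeight i k _ i≤k ⟩
  Σ< (suc k) (λ h → walks i 0 h * (walksFalls k h l * walks (k ∸ i) (endHeight k l h) 0))
    ∎
  where
  open ≡-Reasoning
  F : List Step → ℕ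
  F p = 𝟙 (staysAndReturns 0 p) * δ (falls (interval i k p)) l
  toAxis : ℕ → List Step → ℕ
  toAxis h′ R = walk h′ R (λ e → δ e 0)
  Φ : ℕ → List Step → List Step → ℕ
  Φ h M R = walk h M (λ h′ → toAxis h′ R) * δ (falls M) l
  x+[y+z]≡y+[x+z] : ∀ x y z → x + (y + z) ≡ y + (x + z)
  x+[y+z]≡y+[x+z] = solve-∀
  2k≡i+[k+[k∸i]] : 2 * k ≡ i + (k + (k ∸ i))
  2k≡i+[k+[k∸i]] = trans (cong (k +_) (trans (+-identityʳ k) (sym (m+[n∸m]≡n i≤k))))
                         (x+[y+z]≡y+[x+z] k i (k ∸ i))
  split : ∀ A M R → length A ≡ i → length M ≡ k → F (A ++ M ++ R) ≡ walk 0 A (λ h → Φ h M R)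
  split A M R ∣A∣≡i ∣M∣≡k = begin
    F (A ++ M ++ R)
      ≡⟨ cong₂ (λ x y → x * δ (falls y) l) (staysAndReturns≡walk 0 (A ++ M ++ R))
                                            (interval-++ A M R ∣A∣≡i ∣M∣≡k) ⟩
    walk 0 (A ++ M ++ R) (λ e → δ e 0) * δ (falls M) l
      ≡⟨ cong (_* δ (falls M) l) (trans (walk-++ 0 A (M ++ R) _) (walk-ext 0 A (λ h → walk-++ h M R _))) ⟩
    walk 0 A (λ h → walk h M (λ h′ → walk h′ R (λ e → δ e 0))) * δ (falls M) l
      ≡⟨ walk-*ʳ 0 A _ (δ (falls M) l) ⟩
    walk 0 A (λ h → Φ h M R)
      ∎
  pull : ∀ A → Σpath k (λ M → Σpath (k ∸ i) (λ R → walk 0 A (λ h → Φ h M R)))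
             ≡ walk 0 A (λ h → Σpath k (λ M → Σpath (k ∸ i) (Φ h M)))
  pull A = trans (Σpath-ext k (λ M → Σpath-walk (k ∸ i) 0 A (λ h → Φ h M)))
                 (Σpath-walk k 0 A (λ h M → Σpath (k ∸ i) (Φ h M)))
  middleAndEnd : ∀ h → Σpath k (λ M → Σpath (k ∸ i) (Φ h M))
                     ≡ walksFalls k h l * walks (k ∸ i) (endHeight k l h) 0
  middleAndEnd h = begin
    Σpath k (λ M → Σpath (k ∸ i) (Φ h M))
      ≡⟨ Σpath-ext k (λ M → Σpath-*ʳ (k ∸ i) (λ R → walk h M (λ h′ → toAxis h′ R)) (δ (falls M) l)) ⟩
    Σpath k (λ M → Σpath (k ∸ i) (λ R → walk h M (λ h′ → toAxis h′ R)) * δ (falls M) l)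
      ≡⟨ Σpath-ext k (λ M → cong (_* δ (falls M) l) (Σpath-walk (k ∸ i) h M toAxis)) ⟩
    Σpath k (λ M → walk h M (λ h′ → walks (k ∸ i) h′ 0) * δ (falls M) l)
      ≡⟨ Σpath-walk-withFalls k h l (λ h′ → walks (k ∸ i) h′ 0) ⟩
    walksFalls k h l * walks (k ∸ i) (endHeight k l h) 0
      ∎

-- The number of pairs (Dyck path of semilength k, interval of length k with l falls) in
-- which the interval starts at height h.
intervalsFrom : ℕ → ℕ → ℕ → ℕ
intervalsFrom k l h = walksFalls k h l * walks (suc k) 0 (suc (endHeight k l h + h))

totalIntervals≡Σ<intervalsFrom : ∀ k l → totalIntervals k l ≡ Σ< (suc k) (intervalsFrom k l)
totalIntervals≡Σ<intervalsFrom k l = begin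
  totalIntervals k l
    ≡⟨ totalIntervals≡Σ<Σpath k l ⟩
  Σ< (suc k) (λ i → Σpath (2 * k) (λ p → 𝟙 (staysAndReturns 0 p) * δ (falls (interval i k p)) l))
    ≡⟨ Σ<-cong (suc k) (λ i i<1+k → dyckIntervalsAt k l i (≤-pred i<1+k)) ⟩
  Σ< (suc k) (λ i → Σ< (suc k) (λ h → walks i 0 h * (middle h * end i h)))
    ≡⟨ Σ<-swap (suc k) (suc k) (λ i h → walks i 0 h * (middle h * end i h)) ⟩
  Σ< (suc k) (λ h → Σ< (suc k) (λ i → walks i 0 h * (middle h * end i h)))
    ≡⟨ Σ<-ext (suc k) factorMiddle ⟩
  Σ< (suc k) (λ h → middle h * Σ< (suc k) (λ i → walks i 0 h * end i h))
    ≡⟨ Σ<-ext (suc k) (λ h → cong (middle h *_) (walks-convolution k h (endHeight k l h))) ⟩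
  Σ< (suc k) (intervalsFrom k l)
    ∎
  where
  open ≡-Reasoning
  middle : ℕ → ℕ
  middle h = walksFalls k h l
  end : ℕ → ℕ → ℕ
  end i h = walks (k ∸ i) (endHeight k l h) 0
  x*[y*z]≡y*[x*z] : ∀ x y z → x * (y * z) ≡ y * (x * z)
  x*[y*z]≡y*[x*z] = solve-∀
  factorMiddle : ∀ h → Σ< (suc k) (λ i → walks i 0 h * (middle h * end i h))
                     ≡ middle h * Σ< (suc k) (λ i → walks i 0 h * end i h)
  factorMiddle h = trans (Σ<-ext (suc k) (λ i → x*[y*z]≡y*[x*z] (walks i 0 h) (middle h) (end i h)))
                         (Σ<-*ˡ (suc k) (middle h) (λ i → walks i 0 h * end i h))

-- Opened only here: with ℤ's prefix +_ in scope, sections of ℕ's _+_ such as (x +_) no longer parse.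
open import Data.Integer using (+_)

pos-from-sum : ∀ a b {c} → a + b ≡ c → + a ≡ + c ℤ.- + b
pos-from-sum a b refl = trans (u≡u+v-v (+ a) (+ b)) (cong (ℤ._- + b) (sym (ℤ.pos-+ a b)))
  where
  u≡u+v-v : ∀ u v → u ≡ u ℤ.+ v ℤ.- v
  u≡u+v-v = ℤ-Ring.solve-∀

Σ<-telescope : ∀ r (f : ℕ → ℕ) (ψ : ℕ → ℤ) → (∀ j → j < r → + f j ≡ ψ (suc j) ℤ.- ψ j) →
               + Σ< r f ≡ ψ r ℤ.- ψ 0
Σ<-telescope zero    f ψ _    = sym (ℤ.+-inverseʳ (ψ 0))
Σ<-telescope (suc r) f ψ step = begin
  + (f 0 + Σ< r (f ∘ suc))                ≡⟨ ℤ.pos-+ (f 0) (Σ< r (f ∘ suc)) ⟩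
  + f 0 ℤ.+ + Σ< r (f ∘ suc)              ≡⟨ cong₂ ℤ._+_ (step 0 z<s) (Σ<-telescope r _ (ψ ∘ suc) step′) ⟩
  (ψ 1 ℤ.- ψ 0) ℤ.+ (ψ (suc r) ℤ.- ψ 1)  ≡⟨ cancel (ψ 0) (ψ 1) (ψ (suc r)) ⟩
  ψ (suc r) ℤ.- ψ 0                       ∎
  where
  open ≡-Reasoning
  step′ : ∀ j → j < r → + f (suc j) ≡ ψ (suc (suc j)) ℤ.- ψ (suc j)
  step′ j j<r = step (suc j) (s<s j<r)
  cancel : ∀ a b c → (b ℤ.- a) ℤ.+ (c ℤ.- b) ≡ c ℤ.- a
  cancel = ℤ-Ring.solve-∀

module Evaluation (n l : ℕ) (l≤n : l ≤ n) where

  X : ℤ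
  X = + (n C l)

  ψ : ℕ → ℤ
  ψ r = X ℤ.* + (suc n C⁻ r) ℤ.- + (n C⁻ r) ℤ.* + (n C⁻ pred r)

  top : ℕ → ℕ
  top h = suc (endHeight n l h + h)

  intervalsFrom-above : ∀ h → l < h → intervalsFrom n l h ≡ 0
  intervalsFrom-above h l<h =
    trans (cong (walksFalls n h l *_) (walks-unreachable (suc n) 0 (top h) (s≤s n<end+h))) (*-zeroʳ (walksFalls n h l))
    where
    open ≤-Reasoning
    n<end+h : n < endHeight n l h + h
    n<end+h = begin-strict
      n                      ≡⟨ m∸n+n≡m l≤n ⟨
      (n ∸ l) + l            <⟨ +-monoʳ-< (n ∸ l) l<h ⟩
      (n ∸ l) + h            ≤⟨ +-monoˡ-≤ h (m≤n+m (n ∸ l) (h ∸ l)) ⟩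
      (h ∸ l) + (n ∸ l) + h  ≡⟨ cong (_+ h) (+-∸-comm (n ∸ l) (<⇒≤ l<h)) ⟨
      endHeight n l h + h    ∎

  intervalsFrom-below : ∀ j → j ≤ l → n < j + l → intervalsFrom n l (l ∸ j) ≡ 0
  intervalsFrom-below j j≤l n<j+l = cong (_* walks (suc n) 0 (top (l ∸ j))) (walksFalls-vanish n (l ∸ j) l n+h<2l)
    where
    open ≤-Reasoning
    x+y+z≡y+[x+z] : ∀ x y z → x + y + z ≡ y + (x + z)
    x+y+z≡y+[x+z] = solve-∀
    n+h<2l : n + (l ∸ j) < 2 * l
    n+h<2l = begin-strict
      n + (l ∸ j)        <⟨ +-monoˡ-< (l ∸ j) n<j+l ⟩
      j + l + (l ∸ j)    ≡⟨ x+y+z≡y+[x+z] j l (l ∸ j) ⟩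
      l + (j + (l ∸ j))  ≡⟨ cong (λ x → l + x) (m+[n∸m]≡n j≤l) ⟩
      l + l              ≡⟨ cong (λ x → l + x) (+-identityʳ l) ⟨
      2 * l              ∎

  top-l∸j : ∀ j → j ≤ l → j + l ≤ n → top (l ∸ j) + 2 * j ≡ suc n
  top-l∸j j j≤l j+l≤n = cong suc (begin
    endHeight n l h + h + 2 * j    ≡⟨ x+y+2z≡x+z+[y+z] (endHeight n l h) h j ⟩
    endHeight n l h + j + (h + j)  ≡⟨ cong₂ _+_ end+j≡n∸l h+j≡l ⟩
    (n ∸ l) + l                    ≡⟨ m∸n+n≡m l≤n ⟩
    n                              ∎)
    where
    open ≡-Reasoning
    h = l ∸ j
    h+j≡l : h + j ≡ l
    h+j≡l = m∸n+n≡m j≤l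
    end+j≡n∸l : endHeight n l h + j ≡ n ∸ l
    end+j≡n∸l = begin
      h + (n ∸ l) ∸ l + j        ≡⟨ cong (λ x → h + (n ∸ l) ∸ x + j) h+j≡l ⟨
      h + (n ∸ l) ∸ (h + j) + j  ≡⟨ cong (_+ j) ([m+n]∸[m+o]≡n∸o h (n ∸ l) j) ⟩
      (n ∸ l) ∸ j + j            ≡⟨ m∸n+n≡m (m+n≤o⇒m≤o∸n j j+l≤n) ⟩
      n ∸ l                      ∎
    x+y+2z≡x+z+[y+z] : ∀ x y z → x + y + 2 * z ≡ x + z + (y + z)
    x+y+2z≡x+z+[y+z] = solve-∀

  telescoping-identity : ∀ X c c⁻ c⁻⁻ D D⁻ → D ≡ c⁻ ℤ.+ c → D⁻ ≡ c⁻⁻ ℤ.+ c⁻ →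
                         (X ℤ.- c⁻) ℤ.* (D ℤ.- D⁻)
                         ≡ (X ℤ.* D ℤ.- c ℤ.* c⁻) ℤ.- (X ℤ.* D⁻ ℤ.- c⁻ ℤ.* c⁻⁻)
  telescoping-identity X c c⁻ c⁻⁻ _ _ refl refl = identity X c c⁻ c⁻⁻
    where
    identity : ∀ X c c⁻ c⁻⁻ → (X ℤ.- c⁻) ℤ.* ((c⁻ ℤ.+ c) ℤ.- (c⁻⁻ ℤ.+ c⁻))
                              ≡ (X ℤ.* (c⁻ ℤ.+ c) ℤ.- c ℤ.* c⁻)
                                ℤ.- (X ℤ.* (c⁻⁻ ℤ.+ c⁻) ℤ.- c⁻ ℤ.* c⁻⁻)
    identity = ℤ-Ring.solve-∀

  -- Both factors are given by the reflection principle: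
  -- intervalsFrom n l (l ∸ j) = (C(n,l) − C(n,j−1)) · (C(n+1,j) − C(n+1,j−1)).
  intervalsFrom≡Δψ : ∀ j → j ≤ l → j + l ≤ n → + intervalsFrom n l (l ∸ j) ≡ ψ (suc j) ℤ.- ψ j
  intervalsFrom≡Δψ j j≤l j+l≤n = begin
    + (walksFalls n h l * walks (suc n) 0 (top h))
      ≡⟨ cong (λ w → + (walksFalls n h l * w)) (walks≡walksFalls (suc n) 0 (top h) j (top-l∸j j j≤l j+l≤n)) ⟩
    + (walksFalls n h l * walksFalls (suc n) 0 j)
      ≡⟨ ℤ.pos-* (walksFalls n h l) (walksFalls (suc n) 0 j) ⟩
    + walksFalls n h l ℤ.* + walksFalls (suc n) 0 j
      ≡⟨ cong₂ ℤ._*_ (pos-from-sum _ (n C⁻ j) middle) (pos-from-sum _ (suc n C⁻ j) firstAndLast) ⟩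
    (X ℤ.- + (n C⁻ j)) ℤ.* (+ (suc n C j) ℤ.- + (suc n C⁻ j))
      ≡⟨ telescoping-identity X (+ (n C j)) (+ (n C⁻ j)) (+ (n C⁻ pred j)) (+ (suc n C j)) (+ (suc n C⁻ j))
                              (pos-+-≡ (n C⁻ j) (n C j) (pascal⁻ n j))
                              (pos-+-≡ (n C⁻ pred j) (n C⁻ j) (C⁻-pascal n j)) ⟩
    ψ (suc j) ℤ.- ψ j
      ∎
    where
    open ≡-Reasoning
    h = l ∸ j
    pos-+-≡ : ∀ {a} b c → a ≡ b + c → + a ≡ + b ℤ.+ + c
    pos-+-≡ b c a≡b+c = trans (cong +_ a≡b+c) (ℤ.pos-+ b c)
    x+[y+z]≡z+x+y : ∀ x y z → x + (y + z) ≡ z + x + y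
    x+[y+z]≡z+x+y = solve-∀
    2l≤n+h : 2 * l ≤ n + h
    2l≤n+h = subst (_≤ n + h) 2l≡j+l+h (+-monoˡ-≤ h j+l≤n)
      where
      2l≡j+l+h : j + l + h ≡ 2 * l
      2l≡j+l+h = sym (trans (cong (λ x → l + x) (trans (+-identityʳ l) (sym (m∸n+n≡m j≤l))))
                            (x+[y+z]≡z+x+y l h j))
    2j≤1+n : 2 * j ≤ suc n + 0
    2j≤1+n = ≤-trans (+-monoʳ-≤ j (subst (_≤ l) (sym (+-identityʳ j)) j≤l))
                     (≤-trans j+l≤n (≤-trans (n≤1+n n) (m≤m+n (suc n) 0)))
    middle : walksFalls n h l + n C⁻ j ≡ n C l
    middle = subst (λ x → walksFalls n h l + n C⁻ x ≡ n C l) (m∸[m∸n]≡n j≤l)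
                   (walksFalls-reflection n h l 2l≤n+h)
    firstAndLast : walksFalls (suc n) 0 j + suc n C⁻ j ≡ suc n C j
    firstAndLast = walksFalls-reflection (suc n) 0 j 2j≤1+n

  ψ-total : ∀ r → n C r ≡ n C l → ψ (suc r) ℤ.- ψ 0 ≡ + ((n C l) * (n C l))
  ψ-total r nCr≡nCl = begin
    ψ (suc r) ℤ.- ψ 0
      ≡⟨ cong₂ (λ D c → X ℤ.* D ℤ.- c ℤ.* + (n C⁻ r) ℤ.- ψ 0) pascal-ℤ (cong +_ nCr≡nCl) ⟩
    X ℤ.* (+ (n C⁻ r) ℤ.+ X) ℤ.- X ℤ.* + (n C⁻ r) ℤ.- ψ 0
      ≡⟨ identity X (+ (n C⁻ r)) ⟩
    X ℤ.* X
      ≡⟨ ℤ.pos-* (n C l) (n C l) ⟨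
    + ((n C l) * (n C l))
      ∎
    where
    open ≡-Reasoning
    pascal-ℤ : + (suc n C r) ≡ + (n C⁻ r) ℤ.+ X
    pascal-ℤ = trans (cong +_ (trans (pascal⁻ n r) (cong (λ x → n C⁻ r + x) nCr≡nCl)))
                     (ℤ.pos-+ (n C⁻ r) (n C l))
    identity : ∀ X a → X ℤ.* (a ℤ.+ X) ℤ.- X ℤ.* a ℤ.- (X ℤ.* + 0 ℤ.- + 0 ℤ.* + 0) ≡ X ℤ.* X
    identity = ℤ-Ring.solve-∀

  jmax : ℕ
  jmax = l ⊓ (n ∸ l)

  jmax≤l : jmax ≤ l
  jmax≤l = m⊓n≤m l (n ∸ l)

  j+l≤n : ∀ {j} → j ≤ jmax → j + l ≤ n
  j+l≤n {j} j≤jmax = subst (j + l ≤_) (m∸n+n≡m l≤n) (+-monoˡ-≤ l (≤-trans j≤jmax (m⊓n≤n l (n ∸ l))))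

  beyond-jmax : ∀ j → jmax < j → j ≤ l → n < j + l
  beyond-jmax j jmax<j j≤l = ≰⇒> (λ j+l≤n → <⇒≱ jmax<j (⊓-glb j≤l (m+n≤o⇒m≤o∸n j j+l≤n)))

  nCjmax≡nCl : n C jmax ≡ n C l
  nCjmax≡nCl with ⊓-sel l (n ∸ l)
  ... | inj₁ jmax≡l   = cong (n C_) jmax≡l
  ... | inj₂ jmax≡n∸l = trans (cong (n C_) jmax≡n∸l) (sym (nCk≡nC[n∸k] l≤n))

  Σ<-intervalsFrom : Σ< (suc n) (intervalsFrom n l) ≡ (n C l) * (n C l)
  Σ<-intervalsFrom = ℤ.+-injective (begin
    + Σ< (suc n) g        ≡⟨ cong +_ (Σ<-truncate g (s≤s l≤n) (λ h l<h _ → intervalsFrom-above h l<h)) ⟩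
    + Σ< (suc l) g        ≡⟨ cong +_ (Σ<-reverse l g) ⟩
    + Σ< (suc l) G        ≡⟨ cong +_ (Σ<-truncate G (s≤s jmax≤l) G-beyond-jmax) ⟩
    + Σ< (suc jmax) G     ≡⟨ Σ<-telescope (suc jmax) G ψ G≡Δψ ⟩
    ψ (suc jmax) ℤ.- ψ 0  ≡⟨ ψ-total jmax nCjmax≡nCl ⟩
    + ((n C l) * (n C l)) ∎)
    where
    open ≡-Reasoning
    g : ℕ → ℕ
    g = intervalsFrom n l
    G : ℕ → ℕ
    G j = g (l ∸ j)
    G-beyond-jmax : ∀ j → jmax < j → j < suc l → G j ≡ 0
    G-beyond-jmax j jmax<j (s≤s j≤l) = intervalsFrom-below j j≤l (beyond-jmax j jmax<j j≤l)
    G≡Δψ : ∀ j → j < suc jmax → + G j ≡ ψ (suc j) ℤ.- ψ j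
    G≡Δψ j (s≤s j≤jmax) = intervalsFrom≡Δψ j (≤-trans j≤jmax jmax≤l) (j+l≤n j≤jmax)

corollary1 : (k l : ℕ) → l ≤ k → totalIntervals k l ≡ (k C l) * (k C l)
corollary1 k l l≤k = trans (totalIntervals≡Σ<intervalsFrom k l) (Evaluation.Σ<-intervalsFrom k l l≤k)
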